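{- For every $n\ge 0$, $$T_n(x,s,q)T_n(x,qs,q)-(x^2+qs)U_{n-1}(x,qs,q)U_{n-1}(x,q^2s,q)=q^{\binom{n+1}{2}}(-s)^n.$$
   Context: Let $q$ be a real number with $q\neq -1$. $T_0(x,s,q)=1$, $T_1(x,s,q)=x$, $T_n(x,s,q)=(1+q^{n-1})xT_{n-1}(x,s,q)+q^{n-1}sT_{n-2}(x,s,q)$ for $n\ge2$; $U_{ -1}(x,s,q)=0$, $U_0(x,s,q)=1$, $U_n(x,s,q)=(1+q^{n})xU_{n-1}(x,s,q)+q^{n-1}sU_{n-2}(x,s,q)$ for $n\ge 1$. -}

module Defs where

open import Level using (Level)
open import Data.Nat using (ℕ; zero; suc)
open import Algebra.Bundles using (CommutativeRing; Semiring)
import Algebra.Definitions.RawSemiring as RS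

module QCheb {c ℓ : Level} (R : CommutativeRing c ℓ) where
  open CommutativeRing R
  open RS (Semiring.rawSemiring semiring) public using (_^_)

  T : ℕ → Carrier → Carrier → Carrier → Carrier
  T zero          x s q = 1#
  T (suc zero)    x s q = x
  T (suc (suc n)) x s q =
    ((1# + q ^ suc n) * x) * T (suc n) x s q + (q ^ suc n * s) * T n x s q

  -- Uprev k x s q  =  U_{k-1}(x,s,q)   (index shifted by one so that U_{-1} = 0 is Uprev 0)
  -- U_{-1} = 0, U_0 = 1, U_m = (1+q^m) x U_{m-1} + q^{m-1} s U_{m-2}  (m ≥ 1)
  Uprev : ℕ → Carrier → Carrier → Carrier → Carrier
  Uprev zero          x s q = 0#
  Uprev (suc zero)    x s q = 1#
  Uprev (suc (suc k)) x s q =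
    ((1# + q ^ suc k) * x) * Uprev (suc k) x s q + (q ^ k * s) * Uprev k x s q

-- T_n(x,t,q) and U_{n-1}(x,qt,q) satisfy the same three-term recurrence, so the pairs
-- P_t(n) = (T_n(x,t,q), U_{n-1}(x,qt,q)) do as well.  The left-hand side is the value
-- W(n,n) of the bilinear form ⟪(X,Z),(Y,V)⟫ = XY − (x² + qs)ZV on P_s(n) and P_{qs}(n), so
-- W satisfies the recurrence in each argument separately.  Hence the values of W on the
-- 2×2 window {n, n+1}² determine those on {n+1, n+2}², and an induction over windows
-- yields W(n,n) = Δ_n with Δ_{n+1} = q^{n+1}(−s)Δ_n, i.e. Δ_n = q^{C(n+1,2)}(−s)^n.
module Submission where

open import Level using (Level; 0ℓ)
open import Data.Nat as ℕ using (ℕ; zero; suc)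
open import Data.Nat.Properties using () renaming (+-suc to ℕ-+-suc)
open import Data.Nat.Combinatorics using (_C_; nC1≡n; nCk+nC[k+1]≡[n+1]C[k+1])
open import Data.Product using (_×_; _,_)
open import Data.Product.Relation.Binary.Pointwise.NonDependent using (Pointwise)
open import Data.Maybe using (Maybe; just; nothing)
open import Relation.Nullary using (¬_; yes; no)
open import Relation.Binary.PropositionalEquality as ≡ using (_≡_)
open import Algebra.Bundles using (CommutativeRing; RawRing)
open import Algebra.Solver.Ring.AlmostCommutativeRing
  using (fromCommutativeRing; _-Raw-AlmostCommutative⟶_)
import Algebra.Solver.Ring
import Algebra.Properties.AbelianGroup
import Algebra.Properties.CommutativeSemigroup
import Algebra.Properties.Group
import Algebra.Properties.Ring
import Algebra.Properties.Semiring.Exp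
import Algebra.Properties.Semiring.Mult.TCOptimised
import Relation.Binary.Reasoning.Setoid
open import Defs

module Differences {c ℓ : Level} (R : CommutativeRing c ℓ) where
  open CommutativeRing R
  open Relation.Binary.Reasoning.Setoid setoid
  open Algebra.Properties.AbelianGroup +-abelianGroup using (⁻¹-anti-homo‿-; ⁻¹-∙-comm)
  open Algebra.Properties.CommutativeSemigroup +-commutativeSemigroup using (interchange)
  open Algebra.Properties.Ring ring using (-‿distribˡ-*; x[y-z]≈xy-xz)

  -+-interchange : ∀ a b c d → (a - b) + (c - d) ≈ (a + c) - (b + d)
  -+-interchange a b c d = begin
    (a - b) + (c - d)     ≈⟨ interchange a (- b) c (- d) ⟩
    (a + c) + (- b + - d) ≈⟨ +-congˡ (⁻¹-∙-comm b d) ⟩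
    (a + c) - (b + d)     ∎

  -*-interchange : ∀ a b c d → (a - b) * (c - d) ≈ (a * c + b * d) - (a * d + b * c)
  -*-interchange a b c d = begin
    (a - b) * (c - d)                 ≈⟨ distribʳ (c - d) a (- b) ⟩
    a * (c - d) + - b * (c - d)       ≈⟨ +-congˡ (-‿distribˡ-* b (c - d)) ⟨
    a * (c - d) - b * (c - d)         ≈⟨ +-cong (x[y-z]≈xy-xz a c d) (-‿cong (x[y-z]≈xy-xz b c d)) ⟩
    (a * c - a * d) - (b * c - b * d) ≈⟨ +-congˡ (⁻¹-anti-homo‿- (b * c) (b * d)) ⟩
    (a * c - a * d) + (b * d - b * c) ≈⟨ -+-interchange (a * c) (a * d) (b * d) (b * c) ⟩
    (a * c + b * d) - (a * d + b * c) ∎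

  -≈-⇐+≈+ : ∀ {a b c d} → a + d ≈ c + b → a - b ≈ c - d
  -≈-⇐+≈+ {a} {b} {c} {d} a+d≈c+b = begin
    a - b             ≈⟨ +-identityʳ (a - b) ⟨
    (a - b) + 0#      ≈⟨ +-congˡ (-‿inverseʳ d) ⟨
    (a - b) + (d - d) ≈⟨ -+-interchange a b d d ⟩
    (a + d) - (b + d) ≈⟨ +-cong a+d≈c+b (-‿cong (+-comm b d)) ⟩
    (c + b) - (d + b) ≈⟨ -+-interchange c d b b ⟨
    (c - d) + (b - b) ≈⟨ +-congˡ (-‿inverseʳ b) ⟩
    (c - d) + 0#      ≈⟨ +-identityʳ (c - d) ⟩
    c - d             ∎

-- Algebra.Solver.Ring needs a coefficient ring with decidable equality mapping into R; the
-- pairs (a , b) of naturals, read as a − b, play the role of ℤ.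
module RingSolver {c ℓ : Level} (R : CommutativeRing c ℓ) where
  open CommutativeRing R
  open Relation.Binary.Reasoning.Setoid setoid
  open Algebra.Properties.AbelianGroup +-abelianGroup using (⁻¹-anti-homo‿-)
  open Algebra.Properties.Group +-group using (ε⁻¹≈ε)
  open Algebra.Properties.Semiring.Mult.TCOptimised semiring
    using (×-homo-+; ×1-homo-*; ×-cong) renaming (_×_ to _×ᴿ_)
  open Differences R

  ℕ² : RawRing 0ℓ 0ℓ
  ℕ² = record
    { Carrier = ℕ × ℕ
    ; _≈_     = _≡_
    ; _+_     = λ { (a , b) (c , d) → (a ℕ.+ c , b ℕ.+ d) }
    ; _*_     = λ { (a , b) (c , d) → (a ℕ.* c ℕ.+ b ℕ.* d , a ℕ.* d ℕ.+ b ℕ.* c) }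
    ; -_      = λ { (a , b) → (b , a) }
    ; 0#      = (0 , 0)
    ; 1#      = (1 , 0)
    }

  ι : ℕ → Carrier
  ι n = n ×ᴿ 1#

  -- Cancelling first makes (0 , 0) and (1 , 0) denote 0# and 1# definitionally, which the
  -- solver's constant terms rely on.
  ⟦_⟧ : ℕ × ℕ → Carrier
  ⟦ (m , zero) ⟧      = ι m
  ⟦ (zero , suc n) ⟧  = - ι (suc n)
  ⟦ (suc m , suc n) ⟧ = ⟦ (m , n) ⟧

  ι-+-homo : ∀ m n → ι (m ℕ.+ n) ≈ ι m + ι n
  ι-+-homo = ×-homo-+ 1#

  ι-difference : ∀ a b c d → a ℕ.+ d ≡ c ℕ.+ b → ι a - ι b ≈ ι c - ι d
  ι-difference a b c d a+d≡c+b = -≈-⇐+≈+ (begin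
    ι a + ι d     ≈⟨ ι-+-homo a d ⟨
    ι (a ℕ.+ d)   ≈⟨ ×-cong a+d≡c+b refl ⟩
    ι (c ℕ.+ b)   ≈⟨ ι-+-homo c b ⟩
    ι c + ι b     ∎)

  ⟦⟧≈ι-ι : ∀ m n → ⟦ (m , n) ⟧ ≈ ι m - ι n
  ⟦⟧≈ι-ι m       zero    = sym (trans (+-congˡ ε⁻¹≈ε) (+-identityʳ (ι m)))
  ⟦⟧≈ι-ι zero    (suc n) = sym (+-identityˡ _)
  ⟦⟧≈ι-ι (suc m) (suc n) = trans (⟦⟧≈ι-ι m n) (ι-difference m n (suc m) (suc n) (ℕ-+-suc m n))

  ι-homo-+* : ∀ a b c d → ι (a ℕ.* b ℕ.+ c ℕ.* d) ≈ ι a * ι b + ι c * ι d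
  ι-homo-+* a b c d = trans (ι-+-homo (a ℕ.* b) (c ℕ.* d)) (+-cong (×1-homo-* a b) (×1-homo-* c d))

  homomorphism : ℕ² -Raw-AlmostCommutative⟶ fromCommutativeRing R
  homomorphism = record
    { ⟦_⟧    = ⟦_⟧
    ; +-homo = λ { (a , b) (c , d) → begin
        ⟦ (a ℕ.+ c , b ℕ.+ d) ⟧         ≈⟨ ⟦⟧≈ι-ι (a ℕ.+ c) (b ℕ.+ d) ⟩
        ι (a ℕ.+ c) - ι (b ℕ.+ d)       ≈⟨ +-cong (ι-+-homo a c) (-‿cong (ι-+-homo b d)) ⟩
        (ι a + ι c) - (ι b + ι d)       ≈⟨ -+-interchange (ι a) (ι b) (ι c) (ι d) ⟨
        (ι a - ι b) + (ι c - ι d)       ≈⟨ +-cong (⟦⟧≈ι-ι a b) (⟦⟧≈ι-ι c d) ⟨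
        ⟦ (a , b) ⟧ + ⟦ (c , d) ⟧       ∎ }
    ; *-homo = λ { (a , b) (c , d) → begin
        ⟦ (a ℕ.* c ℕ.+ b ℕ.* d , a ℕ.* d ℕ.+ b ℕ.* c) ⟧
          ≈⟨ ⟦⟧≈ι-ι (a ℕ.* c ℕ.+ b ℕ.* d) (a ℕ.* d ℕ.+ b ℕ.* c) ⟩
        ι (a ℕ.* c ℕ.+ b ℕ.* d) - ι (a ℕ.* d ℕ.+ b ℕ.* c)
          ≈⟨ +-cong (ι-homo-+* a c b d) (-‿cong (ι-homo-+* a d b c)) ⟩
        (ι a * ι c + ι b * ι d) - (ι a * ι d + ι b * ι c)
          ≈⟨ -*-interchange (ι a) (ι b) (ι c) (ι d) ⟨
        (ι a - ι b) * (ι c - ι d)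
          ≈⟨ *-cong (⟦⟧≈ι-ι a b) (⟦⟧≈ι-ι c d) ⟨
        ⟦ (a , b) ⟧ * ⟦ (c , d) ⟧ ∎ }
    ; -‿homo = λ { (a , b) → begin
        ⟦ (b , a) ⟧    ≈⟨ ⟦⟧≈ι-ι b a ⟩
        ι b - ι a      ≈⟨ ⁻¹-anti-homo‿- (ι a) (ι b) ⟨
        - (ι a - ι b)  ≈⟨ -‿cong (⟦⟧≈ι-ι a b) ⟨
        - ⟦ (a , b) ⟧  ∎ }
    ; 0-homo = refl
    ; 1-homo = refl
    }

  _≟_ : ∀ i j → Maybe (⟦ i ⟧ ≈ ⟦ j ⟧)
  (a , b) ≟ (c , d) with a ℕ.+ d ℕ.≟ c ℕ.+ b
  ... | yes a+d≡c+b = just (begin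
    ⟦ (a , b) ⟧  ≈⟨ ⟦⟧≈ι-ι a b ⟩
    ι a - ι b    ≈⟨ ι-difference a b c d a+d≡c+b ⟩
    ι c - ι d    ≈⟨ ⟦⟧≈ι-ι c d ⟨
    ⟦ (c , d) ⟧  ∎)
  ... | no _ = nothing

  open Algebra.Solver.Ring ℕ² (fromCommutativeRing R) homomorphism _≟_ public
    using (solve; _:=_; con; _:+_; _:*_; _:-_; :-_)

module BilinearForm {c ℓ : Level} (R : CommutativeRing c ℓ) (κ : CommutativeRing.Carrier R)
  where
  open CommutativeRing R
  open RingSolver R

  _≋_ : Carrier × Carrier → Carrier × Carrier → Set ℓ
  _≋_ = Pointwise _≈_ _≈_

  ⟪_,_⟫ : Carrier × Carrier → Carrier × Carrier → Carrier
  ⟪ (x , z) , (y , v) ⟫ = x * y - κ * (z * v)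

  lincomb : Carrier → Carrier × Carrier → Carrier → Carrier × Carrier → Carrier × Carrier
  lincomb a (x₁ , z₁) b (x₀ , z₀) = (a * x₁ + b * x₀ , a * z₁ + b * z₀)

  ⟪⟫-congˡ : ∀ {P P′} S → P ≋ P′ → ⟪ P , S ⟫ ≈ ⟪ P′ , S ⟫
  ⟪⟫-congˡ S (x≈x′ , z≈z′) = +-cong (*-congʳ x≈x′) (-‿cong (*-congˡ (*-congʳ z≈z′)))

  ⟪⟫-congʳ : ∀ {S S′} P → S ≋ S′ → ⟪ P , S ⟫ ≈ ⟪ P , S′ ⟫
  ⟪⟫-congʳ P (y≈y′ , v≈v′) = +-cong (*-congˡ y≈y′) (-‿cong (*-congˡ (*-congˡ v≈v′)))

  ⟪⟫-linearˡ : ∀ a P b Q S → ⟪ lincomb a P b Q , S ⟫ ≈ a * ⟪ P , S ⟫ + b * ⟪ Q , S ⟫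
  ⟪⟫-linearˡ a (x₁ , z₁) b (x₀ , z₀) (y , v) =
    solve 9 (λ k a b x₁ z₁ x₀ z₀ y v →
               (a :* x₁ :+ b :* x₀) :* y :- k :* ((a :* z₁ :+ b :* z₀) :* v)
            := a :* (x₁ :* y :- k :* (z₁ :* v)) :+ b :* (x₀ :* y :- k :* (z₀ :* v)))
          refl κ a b x₁ z₁ x₀ z₀ y v

  ⟪⟫-linearʳ : ∀ P a S b S′ → ⟪ P , lincomb a S b S′ ⟫ ≈ a * ⟪ P , S ⟫ + b * ⟪ P , S′ ⟫
  ⟪⟫-linearʳ (x , z) a (y₁ , v₁) b (y₀ , v₀) =
    solve 9 (λ k x z a b y₁ v₁ y₀ v₀ →
               x :* (a :* y₁ :+ b :* y₀) :- k :* (z :* (a :* v₁ :+ b :* v₀))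
            := a :* (x :* y₁ :- k :* (z :* v₁)) :+ b :* (x :* y₀ :- k :* (z :* v₀)))
          refl κ x z a b y₁ v₁ y₀ v₀

module QChebyshevCassini {c ℓ : Level} (R : CommutativeRing c ℓ) (x s q : CommutativeRing.Carrier R)
  where
  open CommutativeRing R
  open Relation.Binary.Reasoning.Setoid setoid
  open QCheb R
  open RingSolver R
  open BilinearForm R (x * x + q * s)
  open Algebra.Properties.CommutativeSemigroup *-commutativeSemigroup
    using (interchange; x∙yz≈yx∙z)
  open Algebra.Properties.Semiring.Exp semiring using (^-homo-*; ^-congʳ)

  α : ℕ → Carrier
  α n = (1# + q ^ suc n) * x

  β : Carrier → ℕ → Carrier
  β t n = q ^ suc n * t

  TU : Carrier → ℕ → Carrier × Carrier
  TU t n = (T n x t q , Uprev n x (q * t) q)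

  TU-recurrence : ∀ t n → TU t (suc (suc n)) ≋ lincomb (α n) (TU t (suc n)) (β t n) (TU t n)
  TU-recurrence t n = refl , +-congˡ (*-congʳ (x∙yz≈yx∙z (q ^ n) q t))

  W : ℕ → ℕ → Carrier
  W i j = ⟪ TU s i , TU (q * s) j ⟫

  W-recurrenceˡ : ∀ i j → W (suc (suc i)) j ≈ α i * W (suc i) j + β s i * W i j
  W-recurrenceˡ i j = trans (⟪⟫-congˡ (TU (q * s) j) (TU-recurrence s i))
                            (⟪⟫-linearˡ (α i) (TU s (suc i)) (β s i) (TU s i) (TU (q * s) j))

  W-recurrenceʳ : ∀ i j → W i (suc (suc j)) ≈ α j * W i (suc j) + β (q * s) j * W i j
  W-recurrenceʳ i j = trans (⟪⟫-congʳ (TU s i) (TU-recurrence (q * s) j))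
                            (⟪⟫-linearʳ (TU s i) (α j) (TU (q * s) (suc j)) (β (q * s) j) (TU (q * s) j))

  Δ : ℕ → Carrier
  Δ zero    = 1#
  Δ (suc n) = q ^ suc n * - s * Δ n

  record Window (n : ℕ) : Set ℓ where
    field
      diag   : W n n ≈ Δ n
      diag₊  : W (suc n) (suc n) ≈ Δ (suc n)
      lower  : W (suc n) n ≈ x * q ^ n * Δ n
      upper  : W n (suc n) ≈ x * Δ n

  -- In the step identities p stands for q ^ n, so that q ^ suc n is q * p.
  lower-step : ∀ p d → (1# + q * p) * x * (q * p * - s * d) + q * p * s * (x * d)
                         ≈ x * (q * p) * (q * p * - s * d)
  lower-step = solve 5 (λ x s q p d →
      (con (1 , 0) :+ q :* p) :* x :* (q :* p :* :- s :* d) :+ q :* p :* s :* (x :* d)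
    := x :* (q :* p) :* (q :* p :* :- s :* d)) refl x s q

  upper-step : ∀ p d → (1# + q * p) * x * (q * p * - s * d) + q * p * (q * s) * (x * p * d)
                         ≈ x * (q * p * - s * d)
  upper-step = solve 5 (λ x s q p d →
      (con (1 , 0) :+ q :* p) :* x :* (q :* p :* :- s :* d) :+ q :* p :* (q :* s) :* (x :* p :* d)
    := x :* (q :* p :* :- s :* d)) refl x s q

  diag-step : ∀ p d → (1# + q * p) * x * (x * (q * p * - s * d))
                        + q * p * s * ((1# + q * p) * x * (x * d) + q * p * (q * s) * d)
                      ≈ q * (q * p) * - s * (q * p * - s * d)
  diag-step = solve 5 (λ x s q p d →
      (con (1 , 0) :+ q :* p) :* x :* (x :* (q :* p :* :- s :* d))
        :+ q :* p :* s :* ((con (1 , 0) :+ q :* p) :* x :* (x :* d) :+ q :* p :* (q :* s) :* d)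
    := q :* (q :* p) :* :- s :* (q :* p :* :- s :* d)) refl x s q

  window : ∀ n → Window n
  window zero = record
    { diag  = solve 3 (λ x s q →
                  con (1 , 0) :* con (1 , 0) :- (x :* x :+ q :* s) :* (con (0 , 0) :* con (0 , 0))
                := con (1 , 0)) refl x s q
    ; diag₊ = solve 3 (λ x s q →
                  x :* x :- (x :* x :+ q :* s) :* (con (1 , 0) :* con (1 , 0))
                := q :* con (1 , 0) :* :- s :* con (1 , 0)) refl x s q
    ; lower = solve 3 (λ x s q →
                  x :* con (1 , 0) :- (x :* x :+ q :* s) :* (con (1 , 0) :* con (0 , 0))
                := x :* con (1 , 0) :* con (1 , 0)) refl x s q
    ; upper = solve 3 (λ x s q →
                  con (1 , 0) :* x :- (x :* x :+ q :* s) :* (con (0 , 0) :* con (1 , 0))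
                := x :* con (1 , 0)) refl x s q
    }
  window (suc n) = record { diag = diag₊ ; diag₊ = diag₊′ ; lower = lower′ ; upper = upper′ }
    where
    open Window (window n)

    lower′ : W (suc (suc n)) (suc n) ≈ x * q ^ suc n * Δ (suc n)
    lower′ = begin
      W (suc (suc n)) (suc n)                               ≈⟨ W-recurrenceˡ n (suc n) ⟩
      α n * W (suc n) (suc n) + β s n * W n (suc n)         ≈⟨ +-cong (*-congˡ diag₊) (*-congˡ upper) ⟩
      α n * Δ (suc n) + β s n * (x * Δ n)                   ≈⟨ lower-step (q ^ n) (Δ n) ⟩
      x * q ^ suc n * Δ (suc n)                             ∎

    upper′ : W (suc n) (suc (suc n)) ≈ x * Δ (suc n)
    upper′ = begin
      W (suc n) (suc (suc n))                               ≈⟨ W-recurrenceʳ (suc n) n ⟩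
      α n * W (suc n) (suc n) + β (q * s) n * W (suc n) n   ≈⟨ +-cong (*-congˡ diag₊) (*-congˡ lower) ⟩
      α n * Δ (suc n) + β (q * s) n * (x * q ^ n * Δ n)     ≈⟨ upper-step (q ^ n) (Δ n) ⟩
      x * Δ (suc n)                                         ∎

    diag₊′ : W (suc (suc n)) (suc (suc n)) ≈ Δ (suc (suc n))
    diag₊′ = begin
      W (suc (suc n)) (suc (suc n))
        ≈⟨ W-recurrenceˡ n (suc (suc n)) ⟩
      α n * W (suc n) (suc (suc n)) + β s n * W n (suc (suc n))
        ≈⟨ +-cong (*-congˡ upper′) (*-congˡ (W-recurrenceʳ n n)) ⟩
      α n * (x * Δ (suc n)) + β s n * (α n * W n (suc n) + β (q * s) n * W n n)
        ≈⟨ +-congˡ (*-congˡ (+-cong (*-congˡ upper) (*-congˡ diag))) ⟩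
      α n * (x * Δ (suc n)) + β s n * (α n * (x * Δ n) + β (q * s) n * Δ n)
        ≈⟨ diag-step (q ^ n) (Δ n) ⟩
      Δ (suc (suc n))
        ∎

  C2-suc : ∀ n → suc (suc n) C 2 ≡ suc n ℕ.+ suc n C 2
  C2-suc n = ≡.trans (≡.sym (nCk+nC[k+1]≡[n+1]C[k+1] (suc n) 1))
                     (≡.cong (ℕ._+ suc n C 2) (nC1≡n (suc n)))

  Δ-closed : ∀ n → Δ n ≈ q ^ (suc n C 2) * (- s) ^ n
  Δ-closed zero    = sym (*-identityʳ 1#)
  Δ-closed (suc n) = begin
    q ^ suc n * - s * Δ n
      ≈⟨ *-congˡ (Δ-closed n) ⟩
    q ^ suc n * - s * (q ^ (suc n C 2) * (- s) ^ n)
      ≈⟨ interchange (q ^ suc n) (- s) (q ^ (suc n C 2)) ((- s) ^ n) ⟩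
    q ^ suc n * q ^ (suc n C 2) * (- s * (- s) ^ n)
      ≈⟨ *-congʳ (^-homo-* q (suc n) (suc n C 2)) ⟨
    q ^ (suc n ℕ.+ suc n C 2) * (- s) ^ suc n
      ≈⟨ *-congʳ (^-congʳ q (C2-suc n)) ⟨
    q ^ (suc (suc n) C 2) * (- s) ^ suc n
      ∎

theorem2p10 : ∀ {c ℓ : Level} (R : CommutativeRing c ℓ) →
    let open CommutativeRing R in
    let open QCheb R in
    ∀ (x s q : Carrier) → ¬ (q ≈ - 1#) → ∀ (n : ℕ) →
      T n x s q * T n x (q * s) q
        - (x * x + q * s) * (Uprev n x (q * s) q * Uprev n x (q * (q * s)) q)
        ≈ (q ^ (suc n C 2)) * ((- s) ^ n)
theorem2p10 R x s q _ n = CommutativeRing.trans R (Window.diag (window n)) (Δ-closed n)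
  where open QChebyshevCassini R x s q
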